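{- Let $p$ be a binary word with exactly one run. If $p = 0$ or $p = 1$, then $p$ does not have an internal zero at any $n \ge 0$. Otherwise $p$ has length $l \ge 2$, and $p$ has an internal zero at every $n \ge l+1$.
   Context: A binary word is a finite sequence over $\{0,1\}$. An occurrence of $p = p_1\cdots p_l$ in $w = w_1\cdots w_n$ is a choice of indices $1 \le i_1 < \cdots < i_l \le n$ with $w_{i_1}\cdots w_{i_l} = p$; $c_p(w)$ is the number of occurrences, and $B_{n,p}(k)$ is the number of binary words $w$ of length $n$ with $c_p(w)=k$. A run is a maximal block of consecutive equal letters. The word $p$ has an internal zero at $n$ if there exist $0 \le k_1 < k_2 < k_3$ with $B_{n,p}(k_1) \ne 0$, $B_{n,p}(k_3) \ne 0$ and $B_{n,p}(k_2) = 0$. -}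

module Defs where

open import Data.Bool using (Bool; true; false)
import Data.Bool.Properties as BoolP
open import Data.Nat using (ℕ; zero; suc; _≤_; _<_; _≟_)
open import Data.List using (List; []; _∷_; _++_; map; filter; length; replicate)
open import Data.List.Properties using (≡-dec)
open import Data.Product using (Σ; _×_; _,_)
open import Relation.Binary.PropositionalEquality using (_≡_; _≢_)
open import Relation.Nullary using (¬_)

-- Binary words are lists of Booleans (false = 0, true = 1).
Word : Set
Word = List Bool

allWords : ℕ → List Word
allWords zero    = [] ∷ []
allWords (suc n) = map (false ∷_) (allWords n) ++ map (true ∷_) (allWords n)

-- A choice of indices i₁ < … < i_l in w is encoded as a selection mask
-- m of the same length as w (m at position i is true iff i is chosen);
-- select m w is the word w_{i₁} ⋯ w_{i_l}.
select : Word → Word → Word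
select (true  ∷ m) (x ∷ w) = x ∷ select m w
select (false ∷ m) (x ∷ w) = select m w
select _           _       = []

_≟w_ : (u v : Word) → Relation.Nullary.Dec (u ≡ v)
_≟w_ = ≡-dec BoolP._≟_

-- c_p(w): number of occurrences of p in w as a (scattered) subword,
-- i.e. number of index choices (masks) selecting exactly p.
occ : Word → Word → ℕ
occ p w = length (filter (λ m → select m w ≟w p) (allWords (length w)))

B : ℕ → Word → ℕ → ℕ
B n p k = length (filter (λ w → occ p w ≟ k) (allWords n))

InternalZero : ℕ → Word → Set
InternalZero n p =
  Σ ℕ λ k₁ → Σ ℕ λ k₂ → Σ ℕ λ k₃ →
    k₁ < k₂ × k₂ < k₃ × B n p k₁ ≢ 0 × B n p k₃ ≢ 0 × B n p k₂ ≡ 0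

OneRun : Word → Set
OneRun p = Σ Bool λ b → Σ ℕ λ l → 1 ≤ l × p ≡ replicate l b

-- For the one-run word bˡ, choosing l positions among the j letters b of w
-- gives c_{bˡ}(w) = j C l, so the values of c_{bˡ} on words of length n are
-- exactly the j C l with j ≤ n.  For l = 1 these are 0,1,…,n, an interval.
-- For l ≥ 2 the values 0 and (l+1) C l = l+1 ≥ 3 occur when n ≥ l+1, while 2
-- never does: j C l is 0 for j < l, 1 for j = l and at least l+1 for j > l.
module Submission where

open import Defs
open import Data.Bool using (Bool; true; false; not)
open import Data.Bool.Properties using (not-¬) renaming (_≟_ to _≟ᵇ_)
open import Data.List using (List; []; _∷_; _++_; map; filter; length; replicate)
open import Data.List.Properties
  using (∷-injectiveˡ; ∷-injectiveʳ; ++-identityʳ; length-++; length-map; length-replicate;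
         length-filter; filter-++; filter-all; filter-none; filter-some; filter-≐; filter-accept; filter-reject)
open import Data.List.Membership.Propositional using (_∈_; lose)
open import Data.List.Membership.Propositional.Properties
  using (∈-map⁺; ∈-map⁻; ∈-++⁺ˡ; ∈-++⁺ʳ; ∈-++⁻; ∈-filter⁻)
open import Data.List.Relation.Unary.Any using (here)
import Data.List.Relation.Unary.All as All
open import Data.List.Relation.Unary.All.Properties using (replicate⁺)
open import Data.Nat using (ℕ; zero; suc; _+_; _∸_; _≤_; _<_; z≤n; s≤s; _≟_)
open import Data.Nat.Combinatorics using (_C_; nCn≡1; nC1≡n; k>n⇒nCk≡0; nCk+nC[k+1]≡[n+1]C[k+1])
open import Data.Nat.Properties
  using (≤-trans; ≤-<-trans; ≤-reflexive; <-cmp; <⇒≱; <⇒≤; n<1+n; n>0⇒n≢0;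
         +-comm; +-identityʳ; +-mono-≤; m≤m+n; m+[n∸m]≡n)
open import Data.Product using (Σ-syntax; ∃-syntax; _×_; _,_)
open import Data.Sum using (inj₁; inj₂)
open import Function using (_∘_)
open import Level using (Level)
open import Relation.Binary.Definitions using (tri<; tri≈; tri>)
open import Relation.Binary.PropositionalEquality
  using (_≡_; _≢_; refl; sym; trans; cong; cong₂; subst; subst₂; module ≡-Reasoning)
open import Relation.Nullary using (¬_; Dec; yes; no; contradiction)
open import Relation.Unary using (Pred; Decidable)

open ≡-Reasoning

filter-map : {a b p : Level} {A : Set a} {B : Set b} {P : Pred B p}
             (P? : Decidable P) (f : A → B) (xs : List A) →
             filter P? (map f xs) ≡ map f (filter (P? ∘ f) xs)
filter-map P? f []       = refl
filter-map P? f (x ∷ xs) with P? (f x)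
... | yes _ = cong (f x ∷_) (filter-map P? f xs)
... | no  _ = filter-map P? f xs

∈-allWords : (w : Word) → w ∈ allWords (length w)
∈-allWords []          = here refl
∈-allWords (false ∷ w) = ∈-++⁺ˡ (∈-map⁺ (false ∷_) (∈-allWords w))
∈-allWords (true  ∷ w) = ∈-++⁺ʳ _ (∈-map⁺ (true ∷_) (∈-allWords w))

∈-allWords⇒length : {n : ℕ} {w : Word} → w ∈ allWords n → length w ≡ n
∈-allWords⇒length {zero} (here refl) = refl
∈-allWords⇒length {suc n} w∈ with ∈-++⁻ (map (false ∷_) (allWords n)) w∈
... | inj₁ w∈₀ with ∈-map⁻ (false ∷_) w∈₀
...   | v , v∈ , refl = cong suc (∈-allWords⇒length v∈)
∈-allWords⇒length {suc n} w∈ | inj₂ w∈₁ with ∈-map⁻ (true ∷_) w∈₁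
...   | v , v∈ , refl = cong suc (∈-allWords⇒length v∈)

Attained : ℕ → Word → ℕ → Set
Attained n p k = ∃[ w ] length w ≡ n × occ p w ≡ k

attained⇒B≢0 : {n : ℕ} {p : Word} {k : ℕ} → Attained n p k → B n p k ≢ 0
attained⇒B≢0 {p = p} {k} (w , refl , occ≡k) =
  n>0⇒n≢0 (filter-some (λ v → occ p v ≟ k) (lose (∈-allWords w) occ≡k))

B≢0⇒attained : {n : ℕ} {p : Word} {k : ℕ} → B n p k ≢ 0 → Attained n p k
B≢0⇒attained {n} {p} {k} B≢0 with filter (λ v → occ p v ≟ k) (allWords n) in eq
... | [] = contradiction refl B≢0
... | w ∷ _ with ∈-filter⁻ (λ v → occ p v ≟ k) (subst (w ∈_) (sym eq) (here refl))
...   | w∈ , occ≡k = w , ∈-allWords⇒length w∈ , occ≡k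

¬attained⇒B≡0 : {n : ℕ} {p : Word} {k : ℕ} → ¬ Attained n p k → B n p k ≡ 0
¬attained⇒B≡0 {n} {p} {k} ¬att =
  cong length (filter-none (λ v → occ p v ≟ k)
    (All.tabulate λ {w} w∈ occ≡k → ¬att (w , ∈-allWords⇒length w∈ , occ≡k)))

occHead : Word → Bool → Word → ℕ
occHead p x w = length (filter (λ m → (x ∷ select m w) ≟w p) (allWords (length w)))

occ-∷ : (p : Word) (x : Bool) (w : Word) → occ p (x ∷ w) ≡ occ p w + occHead p x w
occ-∷ p x w = begin
  length (filter P? (map (false ∷_) ms ++ map (true ∷_) ms))
    ≡⟨ cong length (filter-++ P? (map (false ∷_) ms) (map (true ∷_) ms)) ⟩
  length (filter P? (map (false ∷_) ms) ++ filter P? (map (true ∷_) ms))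
    ≡⟨ length-++ (filter P? (map (false ∷_) ms)) ⟩
  length (filter P? (map (false ∷_) ms)) + length (filter P? (map (true ∷_) ms))
    ≡⟨ cong₂ _+_ (length-filter-map (false ∷_)) (length-filter-map (true ∷_)) ⟩
  occ p w + occHead p x w ∎
  where
  ms = allWords (length w)
  P? = λ m → select m (x ∷ w) ≟w p
  length-filter-map : (f : Word → Word) → length (filter P? (map f ms)) ≡ length (filter (P? ∘ f) ms)
  length-filter-map f = trans (cong length (filter-map P? f ms)) (length-map f (filter (P? ∘ f) ms))

occHead-[] : (x : Bool) (w : Word) → occHead [] x w ≡ 0
occHead-[] x w = cong length (filter-none _ (All.universal (λ _ ()) (allWords (length w))))

occHead-≡ : (p : Word) (x : Bool) (w : Word) → occHead (x ∷ p) x w ≡ occ p w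
occHead-≡ p x w = cong length (filter-≐ _ _ (∷-injectiveʳ , cong (x ∷_)) (allWords (length w)))

occHead-≢ : (p : Word) {x y : Bool} (w : Word) → x ≢ y → occHead (y ∷ p) x w ≡ 0
occHead-≢ p w x≢y =
  cong length (filter-none _ (All.universal (λ _ → x≢y ∘ ∷-injectiveˡ) (allWords (length w))))

occ-[] : (w : Word) → occ [] w ≡ 1
occ-[] []      = refl
occ-[] (x ∷ w) = trans (occ-∷ [] x w) (cong₂ _+_ (occ-[] w) (occHead-[] x w))

count : Bool → Word → ℕ
count b w = length (filter (_≟ᵇ b) w)

count-∷-≡ : (b : Bool) (w : Word) → count b (b ∷ w) ≡ suc (count b w)
count-∷-≡ b w = cong length (filter-accept (_≟ᵇ b) refl)

count-∷-≢ : {x b : Bool} (w : Word) → x ≢ b → count b (x ∷ w) ≡ count b w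
count-∷-≢ {b = b} w x≢b = cong length (filter-reject (_≟ᵇ b) x≢b)

occ-replicate : (l : ℕ) (b : Bool) (w : Word) → occ (replicate l b) w ≡ count b w C l
occ-replicate zero    b w       = occ-[] w
occ-replicate (suc l) b []      = refl
occ-replicate (suc l) b (x ∷ w) = by-head (x ≟ᵇ b)
  where
  by-head : Dec (x ≡ b) → occ (replicate (suc l) b) (x ∷ w) ≡ count b (x ∷ w) C suc l
  by-head (yes refl) = begin
    occ (x ∷ xˡ) (x ∷ w)                  ≡⟨ occ-∷ (x ∷ xˡ) x w ⟩
    occ (x ∷ xˡ) w + occHead (x ∷ xˡ) x w
      ≡⟨ cong₂ _+_ (occ-replicate (suc l) x w) (trans (occHead-≡ xˡ x w) (occ-replicate l x w)) ⟩
    c C suc l + c C l                     ≡⟨ +-comm (c C suc l) (c C l) ⟩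
    c C l + c C suc l                     ≡⟨ nCk+nC[k+1]≡[n+1]C[k+1] c l ⟩
    suc c C suc l                         ≡⟨ cong (_C suc l) (count-∷-≡ x w) ⟨
    count x (x ∷ w) C suc l               ∎
    where
    xˡ = replicate l x
    c  = count x w
  by-head (no x≢b) = begin
    occ (b ∷ bˡ) (x ∷ w)                  ≡⟨ occ-∷ (b ∷ bˡ) x w ⟩
    occ (b ∷ bˡ) w + occHead (b ∷ bˡ) x w ≡⟨ cong₂ _+_ (occ-replicate (suc l) b w) (occHead-≢ bˡ w x≢b) ⟩
    count b w C suc l + 0                 ≡⟨ +-identityʳ _ ⟩
    count b w C suc l                     ≡⟨ cong (_C suc l) (count-∷-≢ w x≢b) ⟨
    count b (x ∷ w) C suc l               ∎
    where bˡ = replicate l b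

count-replicate-++ : (b : Bool) (j m : ℕ) → count b (replicate j b ++ replicate m (not b)) ≡ j
count-replicate-++ b j m = begin
  length (filter P? (bʲ ++ replicate m (not b)))
    ≡⟨ cong length (filter-++ P? bʲ (replicate m (not b))) ⟩
  length (filter P? bʲ ++ filter P? (replicate m (not b)))
    ≡⟨ cong length (cong₂ _++_ (filter-all P? (replicate⁺ j refl))
                               (filter-none P? (replicate⁺ m (not-¬ refl ∘ sym)))) ⟩
  length (bʲ ++ [])
    ≡⟨ cong length (++-identityʳ bʲ) ⟩
  length bʲ
    ≡⟨ length-replicate j ⟩
  j ∎
  where
  P? = _≟ᵇ b
  bʲ = replicate j b

attained-replicate⁺ : (l : ℕ) (b : Bool) {j n : ℕ} → j ≤ n → Attained n (replicate l b) (j C l)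
attained-replicate⁺ l b {j} {n} j≤n = w , length-w , occ-w
  where
  w = replicate j b ++ replicate (n ∸ j) (not b)
  length-w : length w ≡ n
  length-w = begin
    length w                                      ≡⟨ length-++ (replicate j b) ⟩
    length (replicate j b) + length (replicate (n ∸ j) (not b))
      ≡⟨ cong₂ _+_ (length-replicate j) (length-replicate (n ∸ j)) ⟩
    j + (n ∸ j)                                   ≡⟨ m+[n∸m]≡n j≤n ⟩
    n                                             ∎
  occ-w : occ (replicate l b) w ≡ j C l
  occ-w = trans (occ-replicate l b w) (cong (_C l) (count-replicate-++ b j (n ∸ j)))

attained-replicate⁻ : (l : ℕ) (b : Bool) {n k : ℕ} → Attained n (replicate l b) k →
                      Σ[ j ∈ ℕ ] j ≤ n × j C l ≡ k
attained-replicate⁻ l b (w , refl , occ≡k) =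
  count b w , length-filter (_≟ᵇ b) w , trans (sym (occ-replicate l b w)) occ≡k

k≤n⇒0<nCk : {n k : ℕ} → k ≤ n → 0 < n C k
k≤n⇒0<nCk {n}     {zero}  _         = s≤s z≤n
k≤n⇒0<nCk {suc n} {suc k} (s≤s k≤n) =
  subst (0 <_) (nCk+nC[k+1]≡[n+1]C[k+1] n k) (≤-trans (k≤n⇒0<nCk k≤n) (m≤m+n _ _))

k<n⇒k<nCk : {n k : ℕ} → k < n → k < n C k
k<n⇒k<nCk {suc n} {zero}  _         = s≤s z≤n
k<n⇒k<nCk {suc n} {suc k} (s≤s k<n) =
  subst₂ _≤_ (+-comm (suc k) 1) (nCk+nC[k+1]≡[n+1]C[k+1] n k)
    (+-mono-≤ (k<n⇒k<nCk k<n) (k≤n⇒0<nCk k<n))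

2≤k⇒nCk≢2 : {n k : ℕ} → 2 ≤ k → n C k ≢ 2
2≤k⇒nCk≢2 {n} {k} 2≤k nCk≡2 with <-cmp n k
... | tri< n<k _ _ = 0≢2 (trans (sym (k>n⇒nCk≡0 n<k)) nCk≡2)
  where 0≢2 : 0 ≢ 2
        0≢2 ()
... | tri≈ _ refl _ = 1≢2 (trans (sym (nCn≡1 n)) nCk≡2)
  where 1≢2 : 1 ≢ 2
        1≢2 ()
... | tri> _ _ k<n = <⇒≱ (≤-<-trans 2≤k (k<n⇒k<nCk k<n)) (≤-reflexive nCk≡2)

letter-no-internal-zero : (b : Bool) (n : ℕ) → ¬ InternalZero n (b ∷ [])
letter-no-internal-zero b n (_ , k₂ , k₃ , _ , k₂<k₃ , _ , B₃≢0 , B₂≡0)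
  with attained-replicate⁻ 1 b (B≢0⇒attained B₃≢0)
... | j , j≤n , jC1≡k₃ = attained⇒B≢0 k₂-attained B₂≡0
  where
  k₂≤n : k₂ ≤ n
  k₂≤n = ≤-trans (<⇒≤ (subst (k₂ <_) (trans (sym jC1≡k₃) (nC1≡n j)) k₂<k₃)) j≤n
  k₂-attained : Attained n (b ∷ []) k₂
  k₂-attained = subst (Attained n (b ∷ [])) (nC1≡n k₂) (attained-replicate⁺ 1 b k₂≤n)

run-internal-zero : (b : Bool) {l n : ℕ} → 2 ≤ l → l < n → InternalZero n (replicate l b)
run-internal-zero b {l} {n} 2≤l l<n =
  0 , 2 , suc l C l , s≤s z≤n , 2<[1+l]Cl ,
  attained⇒B≢0 (subst (Attained n (replicate l b)) (k>n⇒nCk≡0 (≤-trans (s≤s z≤n) 2≤l))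
                      (attained-replicate⁺ l b z≤n)) ,
  attained⇒B≢0 (attained-replicate⁺ l b l<n) ,
  ¬attained⇒B≡0 two-not-attained
  where
  2<[1+l]Cl : 2 < suc l C l
  2<[1+l]Cl = ≤-<-trans 2≤l (k<n⇒k<nCk (n<1+n l))
  two-not-attained : ¬ Attained n (replicate l b) 2
  two-not-attained att with attained-replicate⁻ l b att
  ... | j , _ , jCl≡2 = 2≤k⇒nCk≢2 2≤l jCl≡2

mainTheorem11 : (p : Word) → OneRun p →
    ((length p ≡ 1 → (n : ℕ) → ¬ InternalZero n p)
    × (2 ≤ length p → (n : ℕ) → suc (length p) ≤ n → InternalZero n p))
mainTheorem11 p (b , l , _ , refl) rewrite length-replicate l {b} =
  (λ { refl → letter-no-internal-zero b }) ,
  (λ 2≤l _ → run-internal-zero b 2≤l)
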